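{- Let $n\ge 2$ be an integer and let $t_0,\dots,t_{n-1}$ be defined by $t_0=0$ and $t_{k+1}=\frac{n-k}{n-k-1}(t_k+1)$ for $0\le k\le n-2$. Define recursively \[ u_{1}=0,\qquad u_{k+1}=\max\left\{\frac{n-k}{n-k-1}t_{k}, \frac{n-k}{n-k-1}(u_{k}+1)\right\}\quad (1\le k\le n-2). \] Then for every $k\in\{1,\ldots ,n-1\}$, \[ u_{k}=\frac{(k-1)(2n-k+2)}{2(n-k)}. \] -}

module Defs where

open import Data.Nat as ℕ using (ℕ; zero; suc; _∸_)
open import Data.Integer using (+_)
open import Data.Rational using (ℚ; _/_; _+_; _*_; _⊔_; 0ℚ; 1ℚ)

-- The ratio a / b of natural numbers as a rational number.
-- Convention: division by zero yields 0 (never used in the range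
-- relevant to the lemma, where the denominator n-k-1 is ≥ 1).
ratio : ℕ → ℕ → ℚ
ratio a zero    = 0ℚ
ratio a (suc b) = (+ a) / suc b

coef : ℕ → ℕ → ℚ
coef n k = ratio (n ∸ k) (n ∸ k ∸ 1)

t : ℕ → ℕ → ℚ
t n zero    = 0ℚ
t n (suc k) = coef n k * (t n k + 1ℚ)

-- u_1 = 0, u_{k+1} = max{ (n-k)/(n-k-1) t_k , (n-k)/(n-k-1) (u_k + 1) }  (k ≥ 1)
-- u_0 is not used by the paper; we set it to 0 for totality (u 1 = 0 is
-- defined directly and does not depend on u 0).
u : ℕ → ℕ → ℚ
u n zero          = 0ℚ
u n (suc zero)    = 0ℚ
u n (suc (suc j)) = let k = suc j in (coef n k * t n k) ⊔ (coef n k * (u n k + 1ℚ))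

-- Writing n = k + d + 1, the sequence t has the closed form
-- t_k = k (2n - k + 1) / (2 (n - k)), and t_k - (u_k + 1) = 1 / (n - k) > 0.
-- So the maximum in the recursion for u is always attained by its first
-- term, u_{k+1} = (n - k) / (n - k - 1) · t_k, which yields the closed form
-- of u by induction. After clearing denominators every identity is a
-- polynomial identity in ℕ.
module Submission where

open import Defs
open import Data.Nat using (ℕ; zero; suc; NonZero; _≤_; _∸_; _+_; _*_; s≤s; z≤n)
open import Data.Nat.Properties
  using (+-suc; m+n∸m≡n; m≤m+n; *-monoˡ-≤; ≤-trans; ≤-reflexive; m≤n⇒∃[o]m+o≡n)
open import Data.Nat.Tactic.RingSolver using (solve)
open import Data.Integer as ℤ using (+_; +≤+)
open import Data.Integer.Properties using (pos-*; pos-+)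
open import Data.List using (_∷_; [])
open import Data.Product using (_,_)
open import Data.Rational as ℚ using (NonNegative; 0ℚ; 1ℚ; fromℚᵘ)
open import Data.Rational.Properties
  using (toℚᵘ-injective; toℚᵘ-fromℚᵘ; toℚᵘ-homo-+; toℚᵘ-homo-*; toℚᵘ-cancel-≤;
         fromℚᵘ-cong; normalize-nonNeg; *-monoˡ-≤-nonNeg; p≥q⇒p⊔q≡p; module ≤-Reasoning)
open import Data.Rational.Unnormalised as ℚᵘ using (mkℚᵘ; *≡*; *≤*)
open import Data.Rational.Unnormalised.Properties as ℚᵘP
  using (≃-sym; ≃-trans; ≤-respˡ-≃; ≤-respʳ-≃)
open import Relation.Binary.PropositionalEquality
  using (_≡_; refl; sym; trans; cong; cong₂; subst₂; module ≡-Reasoning)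

fromℚᵘ-homo-+ : ∀ x y → fromℚᵘ x ℚ.+ fromℚᵘ y ≡ fromℚᵘ (x ℚᵘ.+ y)
fromℚᵘ-homo-+ x y = toℚᵘ-injective
  (≃-trans (toℚᵘ-homo-+ (fromℚᵘ x) (fromℚᵘ y))
  (≃-trans (ℚᵘP.+-cong (toℚᵘ-fromℚᵘ x) (toℚᵘ-fromℚᵘ y))
           (≃-sym (toℚᵘ-fromℚᵘ (x ℚᵘ.+ y)))))

fromℚᵘ-homo-* : ∀ x y → fromℚᵘ x ℚ.* fromℚᵘ y ≡ fromℚᵘ (x ℚᵘ.* y)
fromℚᵘ-homo-* x y = toℚᵘ-injective
  (≃-trans (toℚᵘ-homo-* (fromℚᵘ x) (fromℚᵘ y))
  (≃-trans (ℚᵘP.*-cong (toℚᵘ-fromℚᵘ x) (toℚᵘ-fromℚᵘ y))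
           (≃-sym (toℚᵘ-fromℚᵘ (x ℚᵘ.* y)))))

fromℚᵘ-mono-≤ : ∀ x y → x ℚᵘ.≤ y → fromℚᵘ x ℚ.≤ fromℚᵘ y
fromℚᵘ-mono-≤ x y x≤y = toℚᵘ-cancel-≤
  (≤-respˡ-≃ (≃-sym (toℚᵘ-fromℚᵘ x)) (≤-respʳ-≃ (≃-sym (toℚᵘ-fromℚᵘ y)) x≤y))

ratio-nonNeg : ∀ a b → NonNegative (ratio a b)
ratio-nonNeg a zero    = _
ratio-nonNeg a (suc b) = normalize-nonNeg a (suc b)

cross-mul⇒ratio-≡ : ∀ a b c d .{{_ : NonZero b}} .{{_ : NonZero d}} →
                    a * d ≡ c * b → ratio a b ≡ ratio c d
cross-mul⇒ratio-≡ a (suc b) c (suc d) eq = fromℚᵘ-cong {mkℚᵘ (+ a) b} {mkℚᵘ (+ c) d}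
  (*≡* (trans (sym (pos-* a (suc d))) (trans (cong +_ eq) (pos-* c (suc b)))))

ratio-zeroˡ : ∀ b → ratio 0 b ≡ 0ℚ
ratio-zeroˡ zero    = refl
ratio-zeroˡ (suc b) = cross-mul⇒ratio-≡ 0 (suc b) 0 1 refl

ratio-monoˡ-≤ : ∀ b .{{_ : NonZero b}} {a c} → a ≤ c → ratio a b ℚ.≤ ratio c b
ratio-monoˡ-≤ (suc b) {a} {c} a≤c = fromℚᵘ-mono-≤ (mkℚᵘ (+ a) b) (mkℚᵘ (+ c) b)
  (*≤* (subst₂ ℤ._≤_ (pos-* a (suc b)) (pos-* c (suc b)) (+≤+ (*-monoˡ-≤ (suc b) a≤c))))

ratio-* : ∀ a b c d .{{_ : NonZero b}} .{{_ : NonZero d}} →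
          ratio a b ℚ.* ratio c d ≡ ratio (a * c) (b * d)
ratio-* a (suc b) c (suc d) = trans (fromℚᵘ-homo-* (mkℚᵘ (+ a) b) (mkℚᵘ (+ c) d))
  (cong (λ z → fromℚᵘ (mkℚᵘ z (d + b * suc d))) (sym (pos-* a c)))

ratio-+ : ∀ a b c d .{{_ : NonZero b}} .{{_ : NonZero d}} →
          ratio a b ℚ.+ ratio c d ≡ ratio (a * d + c * b) (b * d)
ratio-+ a (suc b) c (suc d) = trans (fromℚᵘ-homo-+ (mkℚᵘ (+ a) b) (mkℚᵘ (+ c) d))
  (cong (λ z → fromℚᵘ (mkℚᵘ z (d + b * suc d)))
    (trans (cong₂ ℤ._+_ (sym (pos-* a (suc d))) (sym (pos-* c (suc b))))
           (sym (pos-+ (a * suc d) (c * suc b)))))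

ratio-+1 : ∀ a b .{{_ : NonZero b}} → ratio a b ℚ.+ 1ℚ ≡ ratio (a + b) b
ratio-+1 a (suc b) = trans (ratio-+ a (suc b) 1 1)
  (cross-mul⇒ratio-≡ (a * 1 + 1 * suc b) (suc b * 1) (a + suc b) (suc b) cross)
  where
  cross : (a * 1 + 1 * suc b) * suc b ≡ (a + suc b) * (suc b * 1)
  cross = solve (a ∷ b ∷ [])

coef≡ratio : ∀ k d → coef (k + suc d) k ≡ ratio (suc d) d
coef≡ratio k d = cong (λ m → ratio m (m ∸ 1)) (m+n∸m≡n k (suc d))

t-closed-form : ∀ k d → t (k + suc d) k ≡ ratio (k * (k + 2 * d + 3)) (2 * suc d)
t-closed-form zero    d = sym (ratio-zeroˡ (2 * suc d))
t-closed-form (suc k) d = begin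
    t (suc k + suc d) (suc k)
  ≡⟨ cong (λ m → t m (suc k)) (sym (+-suc k (suc d))) ⟩
    coef (k + suc (suc d)) k ℚ.* (t (k + suc (suc d)) k ℚ.+ 1ℚ)
  ≡⟨ cong₂ (λ c x → c ℚ.* (x ℚ.+ 1ℚ)) (coef≡ratio k (suc d)) (t-closed-form k (suc d)) ⟩
    ratio (2 + d) (1 + d) ℚ.* (ratio numₖ den ℚ.+ 1ℚ)
  ≡⟨ cong (ratio (2 + d) (1 + d) ℚ.*_) (ratio-+1 numₖ den) ⟩
    ratio (2 + d) (1 + d) ℚ.* ratio (numₖ + den) den
  ≡⟨ ratio-* (2 + d) (1 + d) (numₖ + den) den ⟩
    ratio ((2 + d) * (numₖ + den)) ((1 + d) * den)
  ≡⟨ cross-mul⇒ratio-≡ ((2 + d) * (numₖ + den)) ((1 + d) * den) numₖ₊₁ (2 * suc d) cross ⟩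
    ratio numₖ₊₁ (2 * suc d)
  ∎
  where
  open ≡-Reasoning
  numₖ numₖ₊₁ den : ℕ
  numₖ = k * (k + 2 * suc d + 3)
  numₖ₊₁ = suc k * (suc k + 2 * d + 3)
  den = 2 * (2 + d)
  cross : (2 + d) * (k * (k + 2 * suc d + 3) + 2 * (2 + d)) * (2 * suc d)
        ≡ suc k * (suc k + 2 * d + 3) * ((1 + d) * (2 * (2 + d)))
  cross = solve (k ∷ d ∷ [])

u-closed-form : ∀ j d → u (suc j + suc d) (suc j) ≡ ratio (j * (j + 2 * d + 5)) (2 * suc d)

u+1≤t : ∀ j d → u (suc j + suc d) (suc j) ℚ.+ 1ℚ ℚ.≤ t (suc j + suc d) (suc j)
u+1≤t j d = begin
    u n (suc j) ℚ.+ 1ℚ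
  ≡⟨ cong (ℚ._+ 1ℚ) (u-closed-form j d) ⟩
    ratio uₖ den ℚ.+ 1ℚ
  ≡⟨ ratio-+1 uₖ den ⟩
    ratio (uₖ + den) den
  ≤⟨ ratio-monoˡ-≤ den (≤-trans (m≤m+n (uₖ + den) 2) (≤-reflexive gap)) ⟩
    ratio tₖ den
  ≡⟨ t-closed-form (suc j) d ⟨
    t n (suc j)
  ∎
  where
  open ≤-Reasoning
  n uₖ tₖ den : ℕ
  n = suc j + suc d
  uₖ = j * (j + 2 * d + 5)
  tₖ = suc j * (suc j + 2 * d + 3)
  den = 2 * suc d
  gap : j * (j + 2 * d + 5) + 2 * suc d + 2 ≡ suc j * (suc j + 2 * d + 3)
  gap = solve (j ∷ d ∷ [])

u-closed-form zero    d = sym (ratio-zeroˡ (2 * suc d))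
u-closed-form (suc j) d = begin
    u (suc (suc j) + suc d) (suc (suc j))
  ≡⟨ cong (λ m → u m (suc (suc j))) (sym (+-suc (suc j) (suc d))) ⟩
    coef n (suc j) ℚ.* t n (suc j) ℚ.⊔ coef n (suc j) ℚ.* (u n (suc j) ℚ.+ 1ℚ)
  ≡⟨ p≥q⇒p⊔q≡p first-term-dominates ⟩
    coef n (suc j) ℚ.* t n (suc j)
  ≡⟨ cong₂ ℚ._*_ (coef≡ratio (suc j) (suc d)) (t-closed-form (suc j) (suc d)) ⟩
    ratio (2 + d) (1 + d) ℚ.* ratio tₖ den
  ≡⟨ ratio-* (2 + d) (1 + d) tₖ den ⟩
    ratio ((2 + d) * tₖ) ((1 + d) * den)
  ≡⟨ cross-mul⇒ratio-≡ ((2 + d) * tₖ) ((1 + d) * den) uₖ₊₁ (2 * suc d) cross ⟩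
    ratio uₖ₊₁ (2 * suc d)
  ∎
  where
  open ≡-Reasoning
  n tₖ den uₖ₊₁ : ℕ
  n = suc j + suc (suc d)
  first-term-dominates : coef n (suc j) ℚ.* (u n (suc j) ℚ.+ 1ℚ) ℚ.≤ coef n (suc j) ℚ.* t n (suc j)
  first-term-dominates = *-monoˡ-≤-nonNeg (coef n (suc j))
    {{ratio-nonNeg (n ∸ suc j) (n ∸ suc j ∸ 1)}} (u+1≤t j (suc d))
  tₖ = suc j * (suc j + 2 * suc d + 3)
  den = 2 * (2 + d)
  uₖ₊₁ = suc j * (suc j + 2 * d + 5)
  cross : (2 + d) * (suc j * (suc j + 2 * suc d + 3)) * (2 * suc d)
        ≡ suc j * (suc j + 2 * d + 5) * ((1 + d) * (2 * (2 + d)))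
  cross = solve (j ∷ d ∷ [])

lemma2p5 : (n : ℕ) → 2 ≤ n → (k : ℕ) → 1 ≤ k → k ≤ n ∸ 1 →
    u n k ≡ ratio ((k ∸ 1) * (2 * n + 2 ∸ k)) (2 * (n ∸ k))
lemma2p5 (suc (suc _)) (s≤s (s≤s z≤n)) (suc j) (s≤s z≤n) k≤n-1 with m≤n⇒∃[o]m+o≡n k≤n-1
... | d , refl = begin
    u (suc (suc j + d)) (suc j)
  ≡⟨ cong (λ m → u m (suc j)) (sym (+-suc (suc j) d)) ⟩
    u (suc j + suc d) (suc j)
  ≡⟨ u-closed-form j d ⟩
    ratio (j * (j + 2 * d + 5)) (2 * suc d)
  ≡⟨ cong₂ (λ a b → ratio (j * a) (2 * b)) numerator denominator ⟨
    ratio (j * (2 * suc (suc j + d) + 2 ∸ suc j)) (2 * (suc (suc j + d) ∸ suc j))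
  ∎
  where
  open ≡-Reasoning
  shift : 2 * suc (suc j + d) + 2 ≡ suc j + (j + 2 * d + 5)
  shift = solve (j ∷ d ∷ [])
  numerator : 2 * suc (suc j + d) + 2 ∸ suc j ≡ j + 2 * d + 5
  numerator = trans (cong (_∸ suc j) shift) (m+n∸m≡n (suc j) (j + 2 * d + 5))
  denominator : suc (suc j + d) ∸ suc j ≡ suc d
  denominator = trans (cong (_∸ j) (sym (+-suc j d))) (m+n∸m≡n j (suc d))
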